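{- Let $c$ and $n$ be positive integers and let $F_0,F_1,\ldots,F_{c-1}$ be perfect matchings of $K_{2n}$ such that $\ell(F_i)=\{1^{a_{i,1}},2^{a_{i,2}},\ldots,n^{a_{i,n}}\}$, where $a_{i,j}\geq 0$. Then there exists a perfect matching $F$ of $K_{2nc}$ such that $\ell(F)=\{c^{b_1},(2c)^{b_2},\ldots,(nc)^{b_n}\}$, where $b_j=\sum_{i=0}^{c-1}a_{i,j}$ for each $j\in[1,n]$.
   Context: For a positive integer $v$, $K_v$ denotes the complete graph on the vertex set $\{0,1,\ldots,v-1\}$. The length of an edge $\{u,w\}$ of $K_v$ is $\ell(u,w)=\min(|u-w|,\,v-|u-w|)$. For a subgraph $\Gamma$ of $K_v$, $\ell(\Gamma)$ is the list (multiset) of lengths of all edges of $\Gamma$, counted with multiplicity. A perfect matching of $K_{2m}$ is a set of $m$ pairwise disjoint edges covering all vertices. The notation $\{z_1^{e_1},\ldots,z_k^{e_k}\}$ denotes the list containing $e_i$ copies of $z_i$ for each $i$. -}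

module Defs where

open import Data.Nat using (ℕ; suc; _+_; _*_; _∸_; _<_; _⊓_; ∣_-_∣)
open import Data.Product using (_×_; _,_; proj₁; proj₂)
open import Data.List using (List; []; _∷_; map; concatMap; replicate; upTo)
open import Data.Nat.ListAction using (sum)
open import Data.List.Relation.Unary.All using (All)
open import Data.List.Relation.Unary.Unique.Propositional using (Unique)
open import Data.List.Membership.Propositional using (_∈_)

-- An edge {u,w} of K_v is represented as an ordered pair (u , w) with u < w < v.
Edge : Set
Edge = ℕ × ℕ

IsEdgeOf : ℕ → Edge → Set
IsEdgeOf v (u , w) = (u < w) × (w < v)

len : ℕ → Edge → ℕ
len v (u , w) = ∣ u - w ∣ ⊓ (v ∸ ∣ u - w ∣)

vertices : List Edge → List ℕ
vertices = concatMap (λ e → proj₁ e ∷ proj₂ e ∷ [])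

IsPerfectMatching : ℕ → List Edge → Set
IsPerfectMatching v F =
  All (IsEdgeOf v) F × Unique (vertices F) × (∀ x → x < v → x ∈ vertices F)

lengths : ℕ → List Edge → List ℕ
lengths v F = map (len v) F

oneTo : ℕ → List ℕ
oneTo n = map suc (upTo n)

powList : ℕ → (ℕ → ℕ) → (ℕ → ℕ) → List ℕ
powList n e f = concatMap (λ j → replicate (e j) (f j)) (oneTo n)

sumTo : ℕ → (ℕ → ℕ) → ℕ
sumTo c g = sum (map g (upTo c))

-- Take c copies of K_{2n}, scaled by c and shifted by 0, 1, …, c − 1: vertex x of the
-- i-th copy becomes i + x c.  The copies occupy the c residue classes mod c, so the union
-- of the shifted matchings F_i is a perfect matching of K_{2nc}; scaling by c multiplies
-- every edge length by c (the wrap-around 2nc − d·c is scaled as well), so the lengths of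
-- the union are the lengths of all the F_i multiplied by c.
module Submission where

open import Defs
open import Data.Nat using (ℕ; zero; suc; _+_; _*_; _∸_; _⊓_; ∣_-_∣; _<_; _≤_; _%_; _/_; NonZero; >-nonZero; s≤s⁻¹)
open import Data.Nat.Properties
open import Data.Nat.DivMod using (m≡m%n+[m/n]*n; [m+kn]%n≡m%n; m%n<n; m<n⇒m%n≡m; m<n*o⇒m/o<n)
open import Data.Product using (Σ; _×_; _,_; proj₁; proj₂)
open import Data.Sum using (inj₁; inj₂)
open import Data.List using (List; []; _∷_; _++_; map; concatMap; replicate; _∷ʳ_; upTo)
open import Data.List.Properties using (map-++; map-cong; map-∘; map-replicate; upTo-∷ʳ; ++-assoc)
open import Data.Nat.ListAction using (sum)
open import Data.Nat.ListAction.Properties using (sum-++)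
open import Data.List.Relation.Unary.All as All using (All; [])
import Data.List.Relation.Unary.All.Properties as All
open import Data.List.Relation.Unary.AllPairs using ([])
open import Data.List.Relation.Unary.Unique.Propositional using (Unique)
import Data.List.Relation.Unary.Unique.Propositional.Properties as Unique
open import Data.List.Membership.Propositional using (_∈_)
open import Data.List.Membership.Propositional.Properties using (∈-map⁺; ∈-++⁺ˡ; ∈-++⁺ʳ)
open import Data.List.Relation.Binary.Permutation.Propositional using (_↭_; ↭-refl; ↭-reflexive; module PermutationReasoning)
import Data.List.Relation.Binary.Permutation.Propositional.Properties as ↭
open import Relation.Binary.PropositionalEquality using (_≡_; refl; sym; trans; cong; cong₂; subst; module ≡-Reasoning)

mapEdge : (ℕ → ℕ) → Edge → Edge
mapEdge f e = f (proj₁ e) , f (proj₂ e)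

vertices-++ : (F G : List Edge) → vertices (F ++ G) ≡ vertices F ++ vertices G
vertices-++ []      G = refl
vertices-++ (e ∷ F) G = cong (λ vs → proj₁ e ∷ proj₂ e ∷ vs) (vertices-++ F G)

vertices-map : (f : ℕ → ℕ) (F : List Edge) → vertices (map (mapEdge f) F) ≡ map f (vertices F)
vertices-map f []      = refl
vertices-map f (e ∷ F) = cong (λ vs → f (proj₁ e) ∷ f (proj₂ e) ∷ vs) (vertices-map f F)

replicateEach : List ℕ → (ℕ → ℕ) → (ℕ → ℕ) → List ℕ
replicateEach js e f = concatMap (λ j → replicate (e j) (f j)) js

replicate-+ : ∀ m k (x : ℕ) → replicate (m + k) x ≡ replicate m x ++ replicate k x
replicate-+ zero    k x = refl
replicate-+ (suc m) k x = cong (x ∷_) (replicate-+ m k x)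

map-replicateEach : ∀ (g : ℕ → ℕ) js e f → map g (replicateEach js e f) ≡ replicateEach js e (λ j → g (f j))
map-replicateEach g []       e f = refl
map-replicateEach g (j ∷ js) e f = trans (map-++ g (replicate (e j) (f j)) (replicateEach js e f))
  (cong₂ _++_ (map-replicate g (e j) (f j)) (map-replicateEach g js e f))

replicateEach-cong : ∀ js {e e′} f → (∀ j → e j ≡ e′ j) → replicateEach js e f ≡ replicateEach js e′ f
replicateEach-cong []       f e≗e′ = refl
replicateEach-cong (j ∷ js) f e≗e′ =
  cong₂ _++_ (cong (λ m → replicate m (f j)) (e≗e′ j)) (replicateEach-cong js f e≗e′)

replicateEach-zero : ∀ js f → replicateEach js (λ _ → 0) f ≡ []
replicateEach-zero []       f = refl
replicateEach-zero (j ∷ js) f = replicateEach-zero js f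

replicateEach-+ : ∀ js e e′ f →
  replicateEach js e f ++ replicateEach js e′ f ↭ replicateEach js (λ j → e j + e′ j) f
replicateEach-+ []       e e′ f = ↭-refl
replicateEach-+ (j ∷ js) e e′ f = begin
  (R ++ E) ++ (R′ ++ E′)  ≡⟨ ++-assoc R E (R′ ++ E′) ⟩
  R ++ E ++ R′ ++ E′      ↭⟨ ↭.++⁺ˡ R (↭.shifts E R′) ⟩
  R ++ R′ ++ E ++ E′      ≡⟨ sym (++-assoc R R′ (E ++ E′)) ⟩
  (R ++ R′) ++ E ++ E′    ≡⟨ cong (_++ (E ++ E′)) (sym (replicate-+ (e j) (e′ j) (f j))) ⟩
  replicate (e j + e′ j) (f j) ++ E ++ E′
                          ↭⟨ ↭.++⁺ˡ (replicate (e j + e′ j) (f j)) (replicateEach-+ js e e′ f) ⟩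
  replicateEach (j ∷ js) (λ j → e j + e′ j) f ∎
  where
  open PermutationReasoning
  R = replicate (e j) (f j)
  R′ = replicate (e′ j) (f j)
  E = replicateEach js e f
  E′ = replicateEach js e′ f

sumTo-suc : ∀ k (g : ℕ → ℕ) → sumTo (suc k) g ≡ g k + sumTo k g
sumTo-suc k g = begin
  sum (map g (upTo (suc k)))         ≡⟨ cong (λ is → sum (map g is)) (sym (upTo-∷ʳ k)) ⟩
  sum (map g (upTo k ∷ʳ k))          ≡⟨ cong sum (map-++ g (upTo k) (k ∷ [])) ⟩
  sum (map g (upTo k) ++ g k ∷ [])   ≡⟨ sum-++ (map g (upTo k)) (g k ∷ []) ⟩
  sumTo k g + (g k + 0)              ≡⟨ cong (sumTo k g +_) (+-identityʳ (g k)) ⟩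
  sumTo k g + g k                    ≡⟨ +-comm (sumTo k g) (g k) ⟩
  g k + sumTo k g ∎
  where open ≡-Reasoning

spread : ℕ → ℕ → ℕ → ℕ
spread c i x = i + x * c

len-spread : ∀ v c i e → len (v * c) (mapEdge (spread c i) e) ≡ len v e * c
len-spread v c i (u , w) = begin
  ∣ i + u * c - i + w * c ∣ ⊓ (v * c ∸ ∣ i + u * c - i + w * c ∣)
    ≡⟨ cong (λ d → d ⊓ (v * c ∸ d)) (trans (∣m+n-m+o∣≡∣n-o∣ i (u * c) (w * c)) (sym (*-distribʳ-∣-∣ c u w))) ⟩
  ∣ u - w ∣ * c ⊓ (v * c ∸ ∣ u - w ∣ * c)
    ≡⟨ cong (∣ u - w ∣ * c ⊓_) (sym (*-distribʳ-∸ c v ∣ u - w ∣)) ⟩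
  ∣ u - w ∣ * c ⊓ ((v ∸ ∣ u - w ∣) * c)
    ≡⟨ sym (*-distribʳ-⊓ c ∣ u - w ∣ (v ∸ ∣ u - w ∣)) ⟩
  len v (u , w) * c ∎
  where open ≡-Reasoning

IsEdgeOf-spread : ∀ {v c i} .{{_ : NonZero c}} e → i < c → IsEdgeOf v e → IsEdgeOf (v * c) (mapEdge (spread c i) e)
IsEdgeOf-spread {v} {c} {i} (u , w) i<c (u<w , w<v) =
  +-monoʳ-< i (*-monoˡ-< c u<w) ,
  (begin-strict
    i + w * c  <⟨ +-monoˡ-< (w * c) i<c ⟩
    suc w * c  ≤⟨ *-monoˡ-≤ c w<v ⟩
    v * c      ∎)
  where open ≤-Reasoning

spread-injective : ∀ c .{{_ : NonZero c}} i {x y} → spread c i x ≡ spread c i y → x ≡ y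
spread-injective c i {x} {y} eq = *-cancelʳ-≡ x y c (+-cancelˡ-≡ i _ _ eq)

spread-mod : ∀ c .{{_ : NonZero c}} {i} x → i < c → spread c i x % c ≡ i
spread-mod c {i} x i<c = trans ([m+kn]%n≡m%n i x c) (m<n⇒m%n≡m i<c)

module Interleaving (v c : ℕ) .{{_ : NonZero c}} (F : ℕ → List Edge)
  (F-perfect : ∀ i → i < c → IsPerfectMatching v (F i)) where

  layer : ℕ → List Edge
  layer i = map (mapEdge (spread c i)) (F i)

  layers : ℕ → List Edge
  layers zero    = []
  layers (suc k) = layer k ++ layers k

  vertices-layer : ∀ i → vertices (layer i) ≡ map (spread c i) (vertices (F i))
  vertices-layer i = vertices-map (spread c i) (F i)

  layer-residue : ∀ i → i < c → All (λ x → x % c ≡ i) (vertices (layer i))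
  layer-residue i i<c rewrite vertices-layer i =
    All.map⁺ (All.universal (λ x → spread-mod c x i<c) _)

  layers-residue : ∀ k → k ≤ c → All (λ x → x % c < k) (vertices (layers k))
  layers-residue zero    _   = []
  layers-residue (suc k) k<c rewrite vertices-++ (layer k) (layers k) = All.++⁺
    (All.map (λ x%c≡k → ≤-reflexive (cong suc x%c≡k)) (layer-residue k k<c))
    (All.map m≤n⇒m≤1+n (layers-residue k (<⇒≤ k<c)))

  layers-edges : ∀ k → k ≤ c → All (IsEdgeOf (v * c)) (layers k)
  layers-edges zero    _   = []
  layers-edges (suc k) k<c = All.++⁺
    (All.map⁺ (All.map (λ {e} → IsEdgeOf-spread e k<c) (proj₁ (F-perfect k k<c))))
    (layers-edges k (<⇒≤ k<c))

  layers-unique : ∀ k → k ≤ c → Unique (vertices (layers k))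
  layers-unique zero    _   = []
  layers-unique (suc k) k<c rewrite vertices-++ (layer k) (layers k) = Unique.++⁺
    (subst Unique (sym (vertices-layer k))
      (Unique.map⁺ (spread-injective c k) (proj₁ (proj₂ (F-perfect k k<c)))))
    (layers-unique k (<⇒≤ k<c))
    (λ (x∈layer , x∈layers) → <-irrefl
      (All.lookup (layer-residue k k<c) x∈layer)
      (All.lookup (layers-residue k (<⇒≤ k<c)) x∈layers))

  layer⊆layers : ∀ {k i x} → i < k → x ∈ vertices (layer i) → x ∈ vertices (layers k)
  layer⊆layers {suc k} {i} i<1+k x∈ with m≤n⇒m<n∨m≡n (s≤s⁻¹ i<1+k)
  ... | inj₁ i<k  rewrite vertices-++ (layer k) (layers k) = ∈-++⁺ʳ (vertices (layer k)) (layer⊆layers i<k x∈)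
  ... | inj₂ refl rewrite vertices-++ (layer i) (layers i) = ∈-++⁺ˡ x∈

  -- x = spread c (x % c) (x / c) is vertex x / c of layer x % c.
  layers-cover : ∀ x → x < v * c → x ∈ vertices (layers c)
  layers-cover x x<vc = subst (_∈ vertices (layers c)) (sym (m≡m%n+[m/n]*n x c))
    (layer⊆layers (m%n<n x c)
      (subst (spread c (x % c) (x / c) ∈_) (sym (vertices-layer (x % c)))
        (∈-map⁺ (spread c (x % c))
          (proj₂ (proj₂ (F-perfect (x % c) (m%n<n x c))) (x / c) (m<n*o⇒m/o<n x<vc)))))

  layers-perfect : IsPerfectMatching (v * c) (layers c)
  layers-perfect = layers-edges c ≤-refl , layers-unique c ≤-refl , layers-cover

  lengths-layer : ∀ i → lengths (v * c) (layer i) ≡ map (_* c) (lengths v (F i))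
  lengths-layer i = begin
    map (len (v * c)) (map (mapEdge (spread c i)) (F i))  ≡⟨ sym (map-∘ (F i)) ⟩
    map (λ e → len (v * c) (mapEdge (spread c i) e)) (F i) ≡⟨ map-cong (len-spread v c i) (F i) ⟩
    map (λ e → len v e * c) (F i)                          ≡⟨ map-∘ (F i) ⟩
    map (_* c) (lengths v (F i))                           ∎
    where open ≡-Reasoning

  lengths-layers : ∀ js (a : ℕ → ℕ → ℕ) →
    (∀ i → i < c → lengths v (F i) ↭ replicateEach js (a i) (λ j → j)) →
    ∀ k → k ≤ c → lengths (v * c) (layers k) ↭ replicateEach js (λ j → sumTo k (λ i → a i j)) (_* c)
  lengths-layers js a F-lengths zero    _   = ↭-reflexive (sym (replicateEach-zero js (_* c)))
  lengths-layers js a F-lengths (suc k) k<c = begin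
    map (len (v * c)) (layer k ++ layers k)
      ≡⟨ map-++ (len (v * c)) (layer k) (layers k) ⟩
    lengths (v * c) (layer k) ++ lengths (v * c) (layers k)
      ↭⟨ ↭.++⁺ lengths-layerₖ (lengths-layers js a F-lengths k (<⇒≤ k<c)) ⟩
    replicateEach js (a k) (_* c) ++ replicateEach js (λ j → sumTo k (λ i → a i j)) (_* c)
      ↭⟨ replicateEach-+ js (a k) _ (_* c) ⟩
    replicateEach js (λ j → a k j + sumTo k (λ i → a i j)) (_* c)
      ≡⟨ replicateEach-cong js (_* c) (λ j → sym (sumTo-suc k (λ i → a i j))) ⟩
    replicateEach js (λ j → sumTo (suc k) (λ i → a i j)) (_* c) ∎
    where
    open PermutationReasoning
    lengths-layerₖ : lengths (v * c) (layer k) ↭ replicateEach js (a k) (_* c)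
    lengths-layerₖ = begin
      lengths (v * c) (layer k)                       ≡⟨ lengths-layer k ⟩
      map (_* c) (lengths v (F k))                    ↭⟨ ↭.map⁺ (_* c) (F-lengths k k<c) ⟩
      map (_* c) (replicateEach js (a k) (λ j → j))   ≡⟨ map-replicateEach (_* c) js (a k) (λ j → j) ⟩
      replicateEach js (a k) (_* c)                   ∎

proposition2p5 : (c n : ℕ) → 1 ≤ c → 1 ≤ n →
    (F : ℕ → List Edge) → (a : ℕ → ℕ → ℕ) →
    (∀ i → i < c → IsPerfectMatching (2 * n) (F i)) →
    (∀ i → i < c → lengths (2 * n) (F i) ↭ powList n (a i) (λ j → j)) →
    Σ (List Edge) (λ G →
      IsPerfectMatching (2 * n * c) G ×
      (lengths (2 * n * c) G ↭ powList n (λ j → sumTo c (λ i → a i j)) (λ j → j * c)))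
proposition2p5 c n 1≤c _ F a F-perfect F-lengths =
  layers c , layers-perfect , lengths-layers (oneTo n) a F-lengths c ≤-refl
  where
  instance
    c-nonZero : NonZero c
    c-nonZero = >-nonZero 1≤c
  open Interleaving (2 * n) c F F-perfect
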